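{- Let $j$ be a positive integer, and define \[ A=\begin{bmatrix}1&1&1&1\\1&1&-1&-1\end{bmatrix},\quad B=\begin{bmatrix}1&1&0&0\\-1&-1&0&0\\0&0&1&1\\0&0&-1&-1\end{bmatrix},\quad D=\begin{bmatrix}-1&1\\1&-1\\-1&-1\\1&1\end{bmatrix}. \] Let $S$ be the $(4j+4)\times(4j+4)$ block matrix with block rows/columns of sizes $2,4,\dots,4,2$ ($j$ blocks of size $4$) in which the $(1,2)$ block is $A$ and the $(2,1)$ block is $-A^T$; the $(k,k+1)$ block is $B$ and the $(k+1,k)$ block is $-B^T$ for $2\le k\le j$; the $(j+1,j+2)$ block is $D$ and the $(j+2,j+1)$ block is $-D^T$; and all other blocks are zero. Then $S$ is the skew-adjacency matrix of an orientation $\mathcal{H}_j^\sigma$ of $\mathcal{H}_j$, with rows/columns ordered $u,v,u_1,u_2,v_1,v_2,u_3,u_4,v_3,v_4,\dots,u_{2j-1},u_{2j},v_{2j-1},v_{2j},u_{2j+1},u_{2j+2}$, and $S^TS=4I$; that is, $\mathcal{H}_j^\sigma$ has optimum skew energy.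
   Context: For a simple graph $G$ on vertices $v_1,\dots,v_n$ with orientation $\sigma$, the skew-adjacency matrix $S(G^\sigma)=[s_{ij}]$ has $s_{ij}=1$, $s_{ji}=-1$ if $\langle v_i,v_j\rangle$ is an arc and $0$ for non-adjacent pairs. Optimum skew energy means the sum of absolute values of the eigenvalues of $S(G^\sigma)$ equals $n\sqrt{\Delta}$ ($\Delta$ the maximum degree), equivalently $S^TS=\Delta I_n$. $\mathcal{H}_j$ is the graph on vertices $u,v,u_1,\dots,u_{2j+2},v_1,\dots,v_{2j}$: $u,v$ each adjacent to $u_1,u_2,v_1,v_2$; for $k=1,\dots,j$, each of $u_{2k-1},u_{2k}$ adjacent to each of $u_{2k+1},u_{2k+2}$; for $k=1,\dots,j-1$, each of $v_{2k-1},v_{2k}$ adjacent to each of $v_{2k+1},v_{2k+2}$; each of $v_{2j-1},v_{2j}$ adjacent to each of $u_{2j+1},u_{2j+2}$. -}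

module Defs where

open import Data.Nat using (ℕ; zero; suc; _+_; _*_; _∸_; _≤_; _<_; _<ᵇ_; _≡ᵇ_)
open import Data.Nat.DivMod using (_/_; _%_)
open import Data.Integer using (ℤ; +_; -_) renaming (_+_ to _+ℤ_; _*_ to _*ℤ_)
open import Data.Fin using (Fin; toℕ; _≟_)
open import Data.Bool using (Bool; true; false; if_then_else_)
open import Data.Sum using (_⊎_)
open import Data.Product using (_×_)
open import Relation.Nullary using (does)
open import Relation.Binary.PropositionalEquality using (_≡_)

Matrix : ℕ → Set
Matrix n = Fin n → Fin n → ℤ

sumFin : ∀ n → (Fin n → ℤ) → ℤ
sumFin zero    f = + 0
sumFin (suc n) f = f Fin.zero +ℤ sumFin n (λ i → f (Fin.suc i))

transpose : ∀ {n} → Matrix n → Matrix n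
transpose M i k = M k i

_·_ : ∀ {n} → Matrix n → Matrix n → Matrix n
_·_ {n} M N i k = sumFin n (λ l → M i l *ℤ N l k)

identity : ∀ {n} → Matrix n
identity i k = if does (i ≟ k) then + 1 else + 0

scale : ∀ {n} → ℤ → Matrix n → Matrix n
scale c M i k = c *ℤ M i k

-- an orientation of a (simple, undirected) graph with adjacency relation Adj:
-- σ i k ≡ true means that ⟨v_i , v_k⟩ is an arc.
IsOrientation : ∀ {n} → (Fin n → Fin n → Set) → (Fin n → Fin n → Bool) → Set
IsOrientation {n} Adj σ =
  (∀ i k → σ i k ≡ true → Adj i k) ×
  (∀ i k → σ i k ≡ true → σ k i ≡ false) ×
  (∀ i k → Adj i k → (σ i k ≡ true) ⊎ (σ k i ≡ true))

skewAdj : ∀ {n} → (Fin n → Fin n → Bool) → Matrix n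
skewAdj σ i k = if σ i k then + 1 else (if σ k i then - (+ 1) else + 0)

-- The graph H_j, with vertex labels u, v, u_a (U a), v_a (V a)  (1-based a)

data HV : Set where
  hu hv : HV
  U V   : ℕ → HV

data IsVertex (j : ℕ) : HV → Set where
  isu : IsVertex j hu
  isv : IsVertex j hv
  isU : ∀ {a} → 1 ≤ a → a ≤ 2 * j + 2 → IsVertex j (U a)
  isV : ∀ {a} → 1 ≤ a → a ≤ 2 * j → IsVertex j (V a)

data Base (j : ℕ) : HV → HV → Set where
  uU : ∀ {x} → x ≤ 1 → Base j hu (U (suc x))
  uV : ∀ {x} → x ≤ 1 → Base j hu (V (suc x))
  vU : ∀ {x} → x ≤ 1 → Base j hv (U (suc x))
  vV : ∀ {x} → x ≤ 1 → Base j hv (V (suc x))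
  -- k = k'+1 ∈ {1..j}: u_{2k-1},u_{2k} adjacent to u_{2k+1},u_{2k+2}
  UU : ∀ {k' a b} → suc k' ≤ j → a ≤ 1 → b ≤ 1 →
       Base j (U (2 * k' + 1 + a)) (U (2 * k' + 3 + b))
  -- k = k'+1 ∈ {1..j-1}: v_{2k-1},v_{2k} adjacent to v_{2k+1},v_{2k+2}
  VV : ∀ {k' a b} → suc (suc k') ≤ j → a ≤ 1 → b ≤ 1 →
       Base j (V (2 * k' + 1 + a)) (V (2 * k' + 3 + b))
  VU : ∀ {a b} → a ≤ 1 → b ≤ 1 →
       Base j (V (2 * j ∸ 1 + a)) (U (2 * j + 1 + b))

HAdj : ℕ → HV → HV → Set
HAdj j x y = Base j x y ⊎ Base j y x

-- the ordering u,v,u_1,u_2,v_1,v_2,u_3,u_4,v_3,v_4,...,u_{2j-1},u_{2j},v_{2j-1},v_{2j},u_{2j+1},u_{2j+2}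
-- (positions 0-based)
labelℕ : ℕ → ℕ → HV
labelℕ j 0 = hu
labelℕ j 1 = hv
labelℕ j p =
  if p <ᵇ 4 * j + 2
  then quad ((p ∸ 2) / 4) ((p ∸ 2) % 4)
  else U (2 * j + 1 + (p ∸ (4 * j + 2)))
  where
  quad : ℕ → ℕ → HV
  quad k 0 = U (2 * k + 1)
  quad k 1 = U (2 * k + 2)
  quad k 2 = V (2 * k + 1)
  quad k _ = V (2 * k + 2)

label : ∀ j → Fin (4 * j + 4) → HV
label j p = labelℕ j (toℕ p)

HAdjFin : ∀ j → Fin (4 * j + 4) → Fin (4 * j + 4) → Set
HAdjFin j p q = HAdj j (label j p) (label j q)

Amat Bmat Dmat : ℕ → ℕ → ℤ
Amat 0 _ = + 1
Amat 1 0 = + 1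
Amat 1 1 = + 1
Amat 1 _ = - (+ 1)
Amat _ _ = + 0

Bmat 0 0 = + 1
Bmat 0 1 = + 1
Bmat 1 0 = - (+ 1)
Bmat 1 1 = - (+ 1)
Bmat 2 2 = + 1
Bmat 2 3 = + 1
Bmat 3 2 = - (+ 1)
Bmat 3 3 = - (+ 1)
Bmat _ _ = + 0

Dmat 0 0 = - (+ 1)
Dmat 0 1 = + 1
Dmat 1 0 = + 1
Dmat 1 1 = - (+ 1)
Dmat 2 0 = - (+ 1)
Dmat 2 1 = - (+ 1)
Dmat 3 0 = + 1
Dmat 3 1 = + 1
Dmat _ _ = + 0

-- 0-based block index and offset inside the block, block sizes 2,4,...,4,2
blk : ℕ → ℕ → ℕ
blk j p = if p <ᵇ 2 then 0 else (if p <ᵇ 4 * j + 2 then suc ((p ∸ 2) / 4) else suc j)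

off : ℕ → ℕ → ℕ
off j p = if p <ᵇ 2 then p else (if p <ᵇ 4 * j + 2 then (p ∸ 2) % 4 else p ∸ (4 * j + 2))

-- the (b, b+1) block (0-based): A for b = 0, D for b = j, B otherwise (1 ≤ b ≤ j-1)
upper : ℕ → ℕ → ℕ → ℕ → ℤ
upper j b r c = if b ≡ᵇ 0 then Amat r c else (if b ≡ᵇ j then Dmat r c else Bmat r c)

Sℕ : ℕ → ℕ → ℕ → ℤ
Sℕ j p q =
  if blk j q ≡ᵇ suc (blk j p) then upper j (blk j p) (off j p) (off j q)
  else (if blk j p ≡ᵇ suc (blk j q) then - upper j (blk j q) (off j q) (off j p)
  else + 0)

Smat : ∀ j → Matrix (4 * j + 4)
Smat j p q = Sℕ j (toℕ p) (toℕ q)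

module Submission where

-- We work in block coordinates: an index of S is a pair (b, r) of a block
-- b ≤ j+1 (block sizes 2, 4, …, 4, 2) and an offset r in it.  There S is
-- block tridiagonal, with X_b ∈ {A, B, D} in block (b, b+1) and -X_bᵀ in
-- block (b+1, b).  Hence the block (b, b) of SᵀS is X_{b-1}ᵀX_{b-1} + X_b X_bᵀ,
-- the block (b, b+2) is -X_b X_{b+1}, and all others vanish; so SᵀS = 4I
-- reduces to AAᵀ = DᵀD = 4I, XᵀX + YYᵀ = 4I and XY = 0 for consecutive
-- blocks X, Y, finitely many identities checked by evaluation.
-- The labelling of block coordinates by vertices is a bijection onto V(H_j)
-- under which the nonzero entries of S are exactly the edges; a
-- skew-symmetric {0, ±1} matrix with this support is the skew-adjacency
-- matrix of the orientation directing each edge towards its +1 entry.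

open import Defs
open import Data.Nat
  using (ℕ; zero; suc; _+_; _*_; _∸_; _≤_; _<_; z≤n; s≤s; s≤s⁻¹; NonZero; _<ᵇ_; _≡ᵇ_)
open import Data.Nat.Properties as ℕ using (+-assoc; +-comm; *-suc; allUpTo?)
open import Data.Nat.DivMod
  using ( _/_; _%_; m<n⇒m/n≡0; +-distrib-/-∣ˡ; m*n/n≡m; /-congˡ; %-congˡ; [m+kn]%n≡m%n
        ; m<n⇒m%n≡m; m%n<n; m<n*o⇒m/o<n; m≡m%n+[m/n]*n)
open import Data.Nat.Divisibility using (m∣m*n)
open import Data.Nat.Tactic.RingSolver using (solve-∀)
open import Data.Integer using (ℤ; +_; -_) renaming (_+_ to _+ℤ_; _*_ to _*ℤ_)
import Data.Integer.Properties as ℤ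
open import Data.Bool using (Bool; true; false; if_then_else_)
open import Data.Fin using (Fin; toℕ; fromℕ<)
import Data.Fin.Properties as Fin
open import Data.Product using (Σ; ∃; _×_; _,_; proj₁; proj₂)
open import Data.Sum using (_⊎_; inj₁; inj₂)
open import Data.Empty using (⊥-elim)
open import Function using (_∘_)
open import Relation.Binary.PropositionalEquality
open import Relation.Nullary using (¬_; ¬?; yes; no; Dec; does)
open import Relation.Nullary.Decidable using (True; toWitness; dec-true; dec-false; _⊎-dec_)

-- The boolean tests used in Defs are the `does` parts of the decision
-- procedures _≟_ and _<?_, so they are evaluated by deciding the relation.

≡ᵇ-refl : ∀ n → (n ≡ᵇ n) ≡ true
≡ᵇ-refl n = dec-true (n ℕ.≟ n) refl

≡ᵇ-≢ : ∀ {m n} → ¬ m ≡ n → (m ≡ᵇ n) ≡ false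
≡ᵇ-≢ {m} {n} = dec-false (m ℕ.≟ n)

<ᵇ-< : ∀ {m n} → m < n → (m <ᵇ n) ≡ true
<ᵇ-< {m} {n} = dec-true (m ℕ.<? n)

<ᵇ-≥ : ∀ {m n} → n ≤ m → (m <ᵇ n) ≡ false
<ᵇ-≥ {m} {n} n≤m = dec-false (m ℕ.<? n) (ℕ.≤⇒≯ n≤m)

sumBelow : ℕ → (ℕ → ℤ) → ℤ
sumBelow zero    f = + 0
sumBelow (suc n) f = f 0 +ℤ sumBelow n (λ i → f (suc i))

sumFin≡sumBelow : ∀ n (g : ℕ → ℤ) → sumFin n (λ l → g (toℕ l)) ≡ sumBelow n g
sumFin≡sumBelow zero    g = refl
sumFin≡sumBelow (suc n) g = cong (g 0 +ℤ_) (sumFin≡sumBelow n (λ i → g (suc i)))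

sumBelow-cong : ∀ n {f g : ℕ → ℤ} → (∀ i → i < n → f i ≡ g i) → sumBelow n f ≡ sumBelow n g
sumBelow-cong zero    f≗g = refl
sumBelow-cong (suc n) f≗g =
  cong₂ _+ℤ_ (f≗g 0 (s≤s z≤n)) (sumBelow-cong n (λ i i<n → f≗g (suc i) (s≤s i<n)))

sumBelow-+ : ∀ a b (f : ℕ → ℤ) → sumBelow (a + b) f ≡ sumBelow a f +ℤ sumBelow b (λ i → f (a + i))
sumBelow-+ zero    b f = sym (ℤ.+-identityˡ _)
sumBelow-+ (suc a) b f =
  trans (cong (f 0 +ℤ_) (sumBelow-+ a b (λ i → f (suc i)))) (sym (ℤ.+-assoc (f 0) _ _))

sumBelow-snoc : ∀ n (f : ℕ → ℤ) → sumBelow (suc n) f ≡ sumBelow n f +ℤ f n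
sumBelow-snoc n f = begin
  sumBelow (suc n) f                        ≡⟨ cong (λ m → sumBelow m f) (+-comm 1 n) ⟩
  sumBelow (n + 1) f                        ≡⟨ sumBelow-+ n 1 f ⟩
  sumBelow n f +ℤ (f (n + 0) +ℤ + 0)        ≡⟨ cong (sumBelow n f +ℤ_) (ℤ.+-identityʳ _) ⟩
  sumBelow n f +ℤ f (n + 0)                 ≡⟨ cong (λ m → sumBelow n f +ℤ f m) (ℕ.+-identityʳ n) ⟩
  sumBelow n f +ℤ f n                       ∎
  where open ≡-Reasoning

block-shift : ∀ c m r → c + 4 + (4 * m + r) ≡ c + (4 * suc m + r)
block-shift = solve-∀

sumBelow-blocks : ∀ k c (f : ℕ → ℤ) →
  sumBelow (4 * k) (λ i → f (c + i)) ≡ sumBelow k (λ m → sumBelow 4 (λ r → f (c + (4 * m + r))))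
sumBelow-blocks zero    c f = refl
sumBelow-blocks (suc k) c f = begin
  sumBelow (4 * suc k) (λ i → f (c + i))
    ≡⟨ cong (λ n → sumBelow n (λ i → f (c + i))) (*-suc 4 k) ⟩
  sumBelow (4 + 4 * k) (λ i → f (c + i))
    ≡⟨ sumBelow-+ 4 (4 * k) (λ i → f (c + i)) ⟩
  head +ℤ sumBelow (4 * k) (λ i → f (c + (4 + i)))
    ≡⟨ cong (head +ℤ_) (sumBelow-cong (4 * k) (λ i _ → cong f (sym (+-assoc c 4 i)))) ⟩
  head +ℤ sumBelow (4 * k) (λ i → f (c + 4 + i))
    ≡⟨ cong (head +ℤ_) (sumBelow-blocks k (c + 4) f) ⟩
  head +ℤ sumBelow k (λ m → sumBelow 4 (λ r → f (c + 4 + (4 * m + r))))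
    ≡⟨ cong (head +ℤ_) (sumBelow-cong k (λ m _ → sumBelow-cong 4 (λ r _ → cong f (block-shift c m r)))) ⟩
  sumBelow (suc k) (λ m → sumBelow 4 (λ r → f (c + (4 * m + r))))
    ∎
  where
  open ≡-Reasoning
  head : ℤ
  head = sumBelow 4 (λ i → f (c + i))

sumBelow-zero : ∀ n {f : ℕ → ℤ} → (∀ i → i < n → f i ≡ + 0) → sumBelow n f ≡ + 0
sumBelow-zero zero    f≡0 = refl
sumBelow-zero (suc n) f≡0 =
  cong₂ _+ℤ_ (f≡0 0 (s≤s z≤n)) (sumBelow-zero n (λ i i<n → f≡0 (suc i) (s≤s i<n)))

sumBelow-single : ∀ n a {f : ℕ → ℤ} → a < n →
  (∀ i → i < n → ¬ i ≡ a → f i ≡ + 0) → sumBelow n f ≡ f a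
sumBelow-single (suc n) zero {f} _ f≡0 =
  trans (cong (f 0 +ℤ_) (sumBelow-zero n (λ i i<n → f≡0 (suc i) (s≤s i<n) λ ())))
        (ℤ.+-identityʳ _)
sumBelow-single (suc n) (suc a) {f} (s≤s a<n) f≡0 =
  trans (cong₂ _+ℤ_ (f≡0 0 (s≤s z≤n) λ ())
                    (sumBelow-single n a a<n (λ i i<n i≢a → f≡0 (suc i) (s≤s i<n) (i≢a ∘ ℕ.suc-injective))))
        (ℤ.+-identityˡ _)

sumBelow-pair : ∀ n a c {f : ℕ → ℤ} → a < c → c < n →
  (∀ i → i < n → ¬ i ≡ a → ¬ i ≡ c → f i ≡ + 0) → sumBelow n f ≡ f a +ℤ f c
sumBelow-pair (suc n) zero    (suc c) {f} _ (s≤s c<n) f≡0 =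
  cong (f 0 +ℤ_) (sumBelow-single n c c<n
    (λ i i<n i≢c → f≡0 (suc i) (s≤s i<n) (λ ()) (i≢c ∘ ℕ.suc-injective)))
sumBelow-pair (suc n) (suc a) (suc c) {f} (s≤s a<c) (s≤s c<n) f≡0 =
  trans (cong₂ _+ℤ_ (f≡0 0 (s≤s z≤n) (λ ()) (λ ()))
          (sumBelow-pair n a c a<c c<n
            (λ i i<n i≢a i≢c →
               f≡0 (suc i) (s≤s i<n) (i≢a ∘ ℕ.suc-injective) (i≢c ∘ ℕ.suc-injective))))
        (ℤ.+-identityˡ _)

decideGrid : ∀ {P : ℕ → ℕ → Set} (P? : ∀ r c → Dec (P r c)) m n →
  {True (allUpTo? (λ r → allUpTo? (P? r) n) m)} → ∀ {r c} → r < m → c < n → P r c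
decideGrid P? m n {ok} r<m c<n = toWitness ok r<m c<n

-- The indices 0 … 4j+3 of S are grouped into the
-- blocks {0,1}, {2+4k, …, 5+4k} (k < j) and {4j+2, 4j+3}; `pos b r` is
-- the index at offset r of block b, and `Coord j b r` says that (b, r)
-- is a valid block coordinate.

pos : ℕ → ℕ → ℕ
pos zero    r = r
pos (suc k) r = 2 + (4 * k + r)

data Coord (j : ℕ) : ℕ → ℕ → Set where
  first  : ∀ {r} → r < 2 → Coord j 0 r
  middle : ∀ {k r} → k < j → r < 4 → Coord j (suc k) r
  last   : ∀ {r} → r < 2 → Coord j (suc j) r

<2⇒<4 : ∀ {r} → r < 2 → r < 4
<2⇒<4 r<2 = ℕ.<-trans r<2 (s≤s (s≤s (s≤s z≤n)))

coord-block< : ∀ {j b r} → Coord j b r → b < 2 + j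
coord-block< (first _)      = s≤s z≤n
coord-block< (middle k<j _) = s≤s (ℕ.m≤n⇒m≤1+n k<j)
coord-block< (last _)       = ℕ.n<1+n _

coord-offset< : ∀ {j b r} → Coord j b r → r < 4
coord-offset< (first r<2)    = <2⇒<4 r<2
coord-offset< (middle _ r<4) = r<4
coord-offset< (last r<2)     = <2⇒<4 r<2

size-split : ∀ j → 4 * j + 4 ≡ 2 + (4 * j + 2)
size-split = solve-∀

middle-pos< : ∀ j k r → k < j → r < 4 → 2 + (4 * k + r) < 4 * j + 2
middle-pos< j k r k<j r<4 = begin-strict
  2 + (4 * k + r)   <⟨ ℕ.+-monoʳ-< 2 (ℕ.+-monoʳ-< (4 * k) r<4) ⟩
  2 + (4 * k + 4)   ≡⟨ cong (λ x → 2 + x) (trans (+-comm (4 * k) 4) (sym (*-suc 4 k))) ⟩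
  2 + 4 * suc k     ≤⟨ ℕ.+-monoʳ-≤ 2 (ℕ.*-monoʳ-≤ 4 k<j) ⟩
  2 + 4 * j         ≡⟨ +-comm 2 (4 * j) ⟩
  4 * j + 2         ∎
  where open ℕ.≤-Reasoning

last-pos≥ : ∀ j r → 4 * j + 2 ≤ 2 + (4 * j + r)
last-pos≥ j r = subst (_≤ 2 + (4 * j + r)) (+-comm 2 (4 * j)) (ℕ.+-monoʳ-≤ 2 (ℕ.m≤m+n (4 * j) r))

last-pos∸ : ∀ j r → 2 + (4 * j + r) ∸ (4 * j + 2) ≡ r
last-pos∸ j r = trans (cong (λ x → 2 + (4 * j + r) ∸ x) (+-comm (4 * j) 2)) (ℕ.m+n∸m≡n (4 * j) r)

pos<size : ∀ {j b r} → Coord j b r → pos b r < 4 * j + 4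
pos<size {j} (first r<2) = ℕ.<-≤-trans (<2⇒<4 r<2) (ℕ.m≤n+m 4 (4 * j))
pos<size {j} (middle {k} {r} k<j r<4) =
  ℕ.<-trans (middle-pos< j k r k<j r<4) (ℕ.+-monoʳ-< (4 * j) (s≤s (s≤s (s≤s z≤n))))
pos<size {j} (last {r} r<2) =
  subst (2 + (4 * j + r) <_) (sym (size-split j)) (ℕ.+-monoʳ-< 2 (ℕ.+-monoʳ-< (4 * j) r<2))

[nk+r]/n≡k : ∀ n k r .{{_ : NonZero n}} → r < n → (n * k + r) / n ≡ k
[nk+r]/n≡k n k r r<n = begin
  (n * k + r) / n      ≡⟨ +-distrib-/-∣ˡ r (m∣m*n k) ⟩
  n * k / n + r / n    ≡⟨ cong₂ _+_ (trans (/-congˡ (ℕ.*-comm n k)) (m*n/n≡m k n)) (m<n⇒m/n≡0 r<n) ⟩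
  k + 0                ≡⟨ ℕ.+-identityʳ k ⟩
  k                    ∎
  where open ≡-Reasoning

[nk+r]%n≡r : ∀ n k r .{{_ : NonZero n}} → r < n → (n * k + r) % n ≡ r
[nk+r]%n≡r n k r r<n = begin
  (n * k + r) % n   ≡⟨ %-congˡ (trans (+-comm (n * k) r) (cong (λ x → r + x) (ℕ.*-comm n k))) ⟩
  (r + k * n) % n   ≡⟨ [m+kn]%n≡m%n r k n ⟩
  r % n             ≡⟨ m<n⇒m%n≡m r<n ⟩
  r                 ∎
  where open ≡-Reasoning

m≡n[m/n]+m%n : ∀ m n .{{_ : NonZero n}} → n * (m / n) + m % n ≡ m
m≡n[m/n]+m%n m n = trans (+-comm (n * (m / n)) (m % n))
  (trans (cong (λ x → m % n + x) (ℕ.*-comm n (m / n))) (sym (m≡m%n+[m/n]*n m n)))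

blk-pos : ∀ {j b r} → Coord j b r → blk j (pos b r) ≡ b
blk-pos (first (s≤s z≤n))      = refl
blk-pos (first (s≤s (s≤s z≤n))) = refl
blk-pos {j} (middle {k} {r} k<j r<4)
  rewrite <ᵇ-< (middle-pos< j k r k<j r<4) = cong suc ([nk+r]/n≡k 4 k r r<4)
blk-pos {j} (last {r} _) rewrite <ᵇ-≥ (last-pos≥ j r) = refl

off-pos : ∀ {j b r} → Coord j b r → off j (pos b r) ≡ r
off-pos (first (s≤s z≤n))      = refl
off-pos (first (s≤s (s≤s z≤n))) = refl
off-pos {j} (middle {k} {r} k<j r<4)
  rewrite <ᵇ-< (middle-pos< j k r k<j r<4) = [nk+r]%n≡r 4 k r r<4
off-pos {j} (last {r} _) rewrite <ᵇ-≥ (last-pos≥ j r) = last-pos∸ j r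

coordOf : ∀ j p → p < 4 * j + 4 → Σ ℕ λ b → Σ ℕ λ r → Coord j b r × pos b r ≡ p
coordOf j 0 _ = 0 , 0 , first (s≤s z≤n) , refl
coordOf j 1 _ = 0 , 1 , first (s≤s (s≤s z≤n)) , refl
coordOf j (suc (suc p)) p<size with p ℕ.<? 4 * j
... | yes p<4j = suc (p / 4) , p % 4 , middle k<j (m%n<n p 4) , cong (λ x → 2 + x) (m≡n[m/n]+m%n p 4)
  where
  k<j : p / 4 < j
  k<j = m<n*o⇒m/o<n (subst (p <_) (ℕ.*-comm 4 j) p<4j)
... | no p≮4j = suc j , p ∸ 4 * j , last r<2 , cong (λ x → 2 + x) (ℕ.m+[n∸m]≡n (ℕ.≮⇒≥ p≮4j))
  where
  r<2 : p ∸ 4 * j < 2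
  r<2 = ℕ.m<n+o⇒m∸n<o p (4 * j) (ℕ.+-cancelˡ-< 2 p (4 * j + 2) (subst (suc (suc p) <_) (size-split j) p<size))

coordOfFin : ∀ j (p : Fin (4 * j + 4)) → Σ ℕ λ b → Σ ℕ λ r → Coord j b r × pos b r ≡ toℕ p
coordOfFin j p = coordOf j (toℕ p) (Fin.toℕ<n p)

-- Integer matrices indexed by ℕ; all blocks of S are viewed as 4×4
-- matrices padded with zeros.

Mat : Set
Mat = ℕ → ℕ → ℤ

infix 4 _≗ₘ_
infixl 7 _ᵀ*_

_≗ₘ_ : Mat → Mat → Set
X ≗ₘ Y = ∀ r c → X r c ≡ Y r c

negT : Mat → Mat
negT X r c = - X c r

negT-cong : ∀ {X Y} → X ≗ₘ Y → negT X ≗ₘ negT Y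
negT-cong X≗Y r c = cong -_ (X≗Y c r)

_ᵀ*_ : Mat → Mat → Mat
(X ᵀ* Y) r c = sumBelow 4 (λ t → X t r *ℤ Y t c)

ᵀ*-cong : ∀ {X X′ Y Y′} → X ≗ₘ X′ → Y ≗ₘ Y′ → X ᵀ* Y ≗ₘ X′ ᵀ* Y′
ᵀ*-cong X≗ Y≗ r c = sumBelow-cong 4 (λ t _ → cong₂ _*ℤ_ (X≗ t r) (Y≗ t c))

δ4 : Mat
δ4 r c = if r ≡ᵇ c then + 4 else + 0

upper-middle : ∀ j k → ¬ suc k ≡ j → upper j (suc k) ≗ₘ Bmat
upper-middle j k k+1≢j r c rewrite ≡ᵇ-≢ k+1≢j = refl

upper-last : ∀ j → 1 ≤ j → upper j j ≗ₘ Dmat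
upper-last (suc j) _ r c rewrite ≡ᵇ-refl j = refl

data Consecutive : Mat → Mat → Set where
  A-B : Consecutive Amat Bmat
  A-D : Consecutive Amat Dmat
  B-B : Consecutive Bmat Bmat
  B-D : Consecutive Bmat Dmat

consecutive : ∀ j k → k < j →
  Σ Mat λ X → Σ Mat λ Y → Consecutive X Y × upper j k ≗ₘ X × upper j (suc k) ≗ₘ Y
consecutive j zero 0<j with 1 ℕ.≟ j
... | yes refl = Amat , Dmat , A-D , (λ _ _ → refl) , upper-last 1 0<j
... | no 1≢j   = Amat , Bmat , A-B , (λ _ _ → refl) , upper-middle j 0 1≢j
consecutive j (suc k) k+1<j with suc (suc k) ℕ.≟ j
... | yes refl  = Bmat , Dmat , B-D , upper-middle j k (λ e → ℕ.<-irrefl e k+1<j) , upper-last j (s≤s z≤n)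
... | no k+2≢j = Bmat , Bmat , B-B , upper-middle j k (λ e → ℕ.<-irrefl e k+1<j) , upper-middle j (suc k) k+2≢j

-- The first block column of S is -Aᵀ, whose Gram matrix is AAᵀ.
first-gram : ∀ {r c} → r < 2 → c < 2 → (negT Amat ᵀ* negT Amat) r c ≡ δ4 r c
first-gram = decideGrid (λ r c → (negT Amat ᵀ* negT Amat) r c ℤ.≟ δ4 r c) 2 2

last-gram : ∀ {r c} → r < 2 → c < 2 → (Dmat ᵀ* Dmat) r c ≡ δ4 r c
last-gram = decideGrid (λ r c → (Dmat ᵀ* Dmat) r c ℤ.≟ δ4 r c) 2 2

Pair-gram Pair-cross : Mat → Mat → ℕ → ℕ → Set
Pair-gram X Y r c = (X ᵀ* X) r c +ℤ (negT Y ᵀ* negT Y) r c ≡ δ4 r c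
Pair-cross X Y r c = (negT X ᵀ* Y) r c ≡ + 0

pair-gram? : ∀ X Y r c → Dec (Pair-gram X Y r c)
pair-gram? X Y r c = (X ᵀ* X) r c +ℤ (negT Y ᵀ* negT Y) r c ℤ.≟ δ4 r c

pair-cross? : ∀ X Y r c → Dec (Pair-cross X Y r c)
pair-cross? X Y r c = (negT X ᵀ* Y) r c ℤ.≟ + 0

pair-gram : ∀ {X Y} → Consecutive X Y → ∀ {r c} → r < 4 → c < 4 → Pair-gram X Y r c
pair-gram A-B = decideGrid (pair-gram? Amat Bmat) 4 4
pair-gram A-D = decideGrid (pair-gram? Amat Dmat) 4 4
pair-gram B-B = decideGrid (pair-gram? Bmat Bmat) 4 4
pair-gram B-D = decideGrid (pair-gram? Bmat Dmat) 4 4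

pair-cross : ∀ {X Y} → Consecutive X Y → ∀ {r c} → r < 4 → c < 4 → Pair-cross X Y r c
pair-cross A-B = decideGrid (pair-cross? Amat Bmat) 4 4
pair-cross A-D = decideGrid (pair-cross? Amat Dmat) 4 4
pair-cross B-B = decideGrid (pair-cross? Bmat Bmat) 4 4
pair-cross B-D = decideGrid (pair-cross? Bmat Dmat) 4 4

blockS : ℕ → ℕ → ℕ → Mat
blockS j b b′ r r′ =
  if b′ ≡ᵇ suc b then upper j b r r′ else (if b ≡ᵇ suc b′ then - upper j b′ r′ r else + 0)

S-pos : ∀ {j b r b′ r′} → Coord j b r → Coord j b′ r′ → Sℕ j (pos b r) (pos b′ r′) ≡ blockS j b b′ r r′
S-pos c c′ rewrite blk-pos c | off-pos c | blk-pos c′ | off-pos c′ = refl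

blockS-super : ∀ j b → blockS j b (suc b) ≗ₘ upper j b
blockS-super j b r r′ rewrite ≡ᵇ-refl b = refl

blockS-sub : ∀ j b → blockS j (suc b) b ≗ₘ negT (upper j b)
blockS-sub j b r r′ rewrite ≡ᵇ-≢ (ℕ.m≢1+n+m b {1}) | ≡ᵇ-refl b = refl

Adjacent : ℕ → ℕ → Set
Adjacent b b′ = b′ ≡ suc b ⊎ b ≡ suc b′

adjacent? : ∀ b b′ → Dec (Adjacent b b′)
adjacent? b b′ with b′ ℕ.≟ suc b | b ℕ.≟ suc b′
... | yes e | _     = yes (inj₁ e)
... | no _  | yes e = yes (inj₂ e)
... | no ≢₁ | no ≢₂ = no λ { (inj₁ e) → ≢₁ e ; (inj₂ e) → ≢₂ e }

blockS-far : ∀ j {b b′} → ¬ Adjacent b b′ → ∀ r r′ → blockS j b b′ r r′ ≡ + 0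
blockS-far j ¬adj r r′ rewrite ≡ᵇ-≢ (¬adj ∘ inj₁) | ≡ᵇ-≢ (¬adj ∘ inj₂) = refl

blockS-anti : ∀ j b r b′ r′ → blockS j b′ b r′ r ≡ - blockS j b b′ r r′
blockS-anti j b r b′ r′ with adjacent? b b′
... | yes (inj₁ refl) = trans (blockS-sub j b r′ r) (cong -_ (sym (blockS-super j b r r′)))
... | yes (inj₂ refl) =
  trans (blockS-super j b′ r′ r) (sym (trans (cong -_ (blockS-sub j b′ r r′)) (ℤ.neg-involutive _)))
... | no ¬adj = trans (blockS-far j (λ { (inj₁ e) → ¬adj (inj₂ e) ; (inj₂ e) → ¬adj (inj₁ e) }) r′ r)
                      (cong -_ (sym (blockS-far j ¬adj r r′)))

-- The (bp, bq) block of SᵀS: the sum over block rows b of S of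
-- (S_{b,bp})ᵀ S_{b,bq}.
gramTerm : ℕ → ℕ → ℕ → ℕ → ℕ → ℕ → ℤ
gramTerm j bp bq rp rq b = (blockS j b bp ᵀ* blockS j b bq) rp rq

gram : ℕ → ℕ → ℕ → Mat
gram j bp bq rp rq = sumBelow (2 + j) (gramTerm j bp bq rp rq)

gram-sym : ∀ j bp bq rp rq → gram j bp bq rp rq ≡ gram j bq bp rq rp
gram-sym j bp bq rp rq =
  sumBelow-cong (2 + j) (λ b _ → sumBelow-cong 4 (λ t _ → ℤ.*-comm (blockS j b bp t rp) (blockS j b bq t rq)))

gramTerm-far : ∀ j {b} bp bq → ¬ Adjacent b bp ⊎ ¬ Adjacent b bq →
  ∀ rp rq → gramTerm j bp bq rp rq b ≡ + 0
gramTerm-far j {b} bp bq (inj₁ ¬adj) rp rq = sumBelow-zero 4 λ t _ →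
  trans (cong (_*ℤ blockS j b bq t rq) (blockS-far j ¬adj t rp)) (ℤ.*-zeroˡ (blockS j b bq t rq))
gramTerm-far j {b} bp bq (inj₂ ¬adj) rp rq = sumBelow-zero 4 λ t _ →
  trans (cong (blockS j b bp t rp *ℤ_) (blockS-far j ¬adj t rq)) (ℤ.*-zeroʳ (blockS j b bp t rp))

gram-single : ∀ j bp bq rp rq a → a < 2 + j →
  (∀ b → b < 2 + j → ¬ b ≡ a → ¬ Adjacent b bp ⊎ ¬ Adjacent b bq) →
  gram j bp bq rp rq ≡ gramTerm j bp bq rp rq a
gram-single j bp bq rp rq a a<j+2 others =
  sumBelow-single (2 + j) a a<j+2 (λ b b<j+2 b≢a → gramTerm-far j bp bq (others b b<j+2 b≢a) rp rq)

gram-pair : ∀ j bp bq rp rq a c → a < c → c < 2 + j →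
  (∀ b → ¬ b ≡ a → ¬ b ≡ c → ¬ Adjacent b bp ⊎ ¬ Adjacent b bq) →
  gram j bp bq rp rq ≡ gramTerm j bp bq rp rq a +ℤ gramTerm j bp bq rp rq c
gram-pair j bp bq rp rq a c a<c c<j+2 others =
  sumBelow-pair (2 + j) a c a<c c<j+2 (λ b _ b≢a b≢c → gramTerm-far j bp bq (others b b≢a b≢c) rp rq)

gram-diagonal : ∀ j {b rp rq} → 1 ≤ j → Coord j b rp → Coord j b rq → gram j b b rp rq ≡ δ4 rp rq
gram-diagonal j {_} {rp} {rq} _ (first rp<2) (first rq<2) = begin
  gram j 0 0 rp rq
    ≡⟨ gram-single j 0 0 rp rq 1 (s≤s (s≤s z≤n)) (λ b _ b≢1 → inj₁ (only-1 b≢1)) ⟩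
  (blockS j 1 0 ᵀ* blockS j 1 0) rp rq
    ≡⟨ ᵀ*-cong (blockS-sub j 0) (blockS-sub j 0) rp rq ⟩
  (negT Amat ᵀ* negT Amat) rp rq
    ≡⟨ first-gram rp<2 rq<2 ⟩
  δ4 rp rq ∎
  where
  open ≡-Reasoning
  only-1 : ∀ {b} → ¬ b ≡ 1 → ¬ Adjacent b 0
  only-1 b≢1 (inj₂ e) = b≢1 e
gram-diagonal j {suc k} {rp} {rq} _ (middle k<j rp<4) (middle _ rq<4)
  with consecutive j k k<j
... | X , Y , XY , X≗ , Y≗ = begin
  gram j (suc k) (suc k) rp rq
    ≡⟨ gram-pair j (suc k) (suc k) rp rq k (2 + k) (ℕ.≤-trans (ℕ.n≤1+n _) (ℕ.n<1+n _)) (s≤s (s≤s k<j))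
         (λ b b≢k b≢k+2 → inj₁ (neighbours b≢k b≢k+2)) ⟩
  (blockS j k (suc k) ᵀ* blockS j k (suc k)) rp rq +ℤ
  (blockS j (2 + k) (suc k) ᵀ* blockS j (2 + k) (suc k)) rp rq
    ≡⟨ cong₂ _+ℤ_ (ᵀ*-cong above above rp rq) (ᵀ*-cong below below rp rq) ⟩
  (X ᵀ* X) rp rq +ℤ (negT Y ᵀ* negT Y) rp rq
    ≡⟨ pair-gram XY rp<4 rq<4 ⟩
  δ4 rp rq ∎
  where
  open ≡-Reasoning
  above : blockS j k (suc k) ≗ₘ X
  above r c = trans (blockS-super j k r c) (X≗ r c)
  below : blockS j (2 + k) (suc k) ≗ₘ negT Y
  below r c = trans (blockS-sub j (suc k) r c) (negT-cong Y≗ r c)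
  neighbours : ∀ {b} → ¬ b ≡ k → ¬ b ≡ 2 + k → ¬ Adjacent b (suc k)
  neighbours b≢k _ (inj₁ e) = b≢k (sym (ℕ.suc-injective e))
  neighbours _ b≢k+2 (inj₂ e) = b≢k+2 e
gram-diagonal j _ (middle k<j _) (last _) = ⊥-elim (ℕ.<-irrefl refl k<j)
gram-diagonal j _ (last _) (middle k<j _) = ⊥-elim (ℕ.<-irrefl refl k<j)
gram-diagonal j {_} {rp} {rq} 1≤j (last rp<2) (last rq<2) = begin
  gram j (suc j) (suc j) rp rq
    ≡⟨ gram-single j (suc j) (suc j) rp rq j (ℕ.≤-trans (ℕ.n<1+n j) (ℕ.n≤1+n _))
         (λ b b<j+2 b≢j → inj₁ (only-j b<j+2 b≢j)) ⟩
  (blockS j j (suc j) ᵀ* blockS j j (suc j)) rp rq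
    ≡⟨ ᵀ*-cong below below rp rq ⟩
  (Dmat ᵀ* Dmat) rp rq
    ≡⟨ last-gram rp<2 rq<2 ⟩
  δ4 rp rq ∎
  where
  open ≡-Reasoning
  below : blockS j j (suc j) ≗ₘ Dmat
  below r c = trans (blockS-super j j r c) (upper-last j 1≤j r c)
  only-j : ∀ {b} → b < 2 + j → ¬ b ≡ j → ¬ Adjacent b (suc j)
  only-j _ b≢j (inj₁ e) = b≢j (sym (ℕ.suc-injective e))
  only-j b<j+2 _ (inj₂ refl) = ℕ.<-irrefl refl b<j+2

-- Block columns two apart meet only in the block row between them, where
-- the product is -X_b X_{b+1} = 0.
gram-two-apart : ∀ j {b rp rq} → Coord j b rp → Coord j (2 + b) rq → gram j b (2 + b) rp rq ≡ + 0
gram-two-apart j {b} {rp} {rq} cp cq with consecutive j b (ℕ.+-cancelˡ-< 2 b j (coord-block< cq))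
... | X , Y , XY , X≗ , Y≗ = begin
  gram j b (2 + b) rp rq
    ≡⟨ gram-single j b (2 + b) rp rq (suc b) (ℕ.<-trans (ℕ.n<1+n _) (coord-block< cq))
         (λ i _ i≢b+1 → only-middle i≢b+1) ⟩
  (blockS j (suc b) b ᵀ* blockS j (suc b) (2 + b)) rp rq
    ≡⟨ ᵀ*-cong left right rp rq ⟩
  (negT X ᵀ* Y) rp rq
    ≡⟨ pair-cross XY (coord-offset< cp) (coord-offset< cq) ⟩
  + 0 ∎
  where
  open ≡-Reasoning
  left : blockS j (suc b) b ≗ₘ negT X
  left r c = trans (blockS-sub j b r c) (negT-cong X≗ r c)
  right : blockS j (suc b) (2 + b) ≗ₘ Y
  right r c = trans (blockS-super j (suc b) r c) (Y≗ r c)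
  only-middle : ∀ {i} → ¬ i ≡ suc b → ¬ Adjacent i b ⊎ ¬ Adjacent i (2 + b)
  only-middle {i} i≢b+1 with adjacent? i b
  ... | no ¬adj        = inj₁ ¬adj
  ... | yes (inj₂ e)   = ⊥-elim (i≢b+1 e)
  ... | yes (inj₁ refl) = inj₂ λ { (inj₁ e) → ℕ.m≢1+n+m i {1} (sym (ℕ.suc-injective e))
                                 ; (inj₂ e) → ℕ.m≢1+n+m i {3} e }

common-neighbour : ∀ {b x y} → Adjacent b x → Adjacent b y → x ≡ y ⊎ y ≡ 2 + x ⊎ x ≡ 2 + y
common-neighbour (inj₁ refl) (inj₁ refl) = inj₁ refl
common-neighbour (inj₁ refl) (inj₂ refl) = inj₂ (inj₂ refl)
common-neighbour (inj₂ refl) (inj₁ refl) = inj₂ (inj₁ refl)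
common-neighbour (inj₂ refl) (inj₂ e)    = inj₁ (ℕ.suc-injective e)

gram-off-diagonal : ∀ j {bp rp bq rq} → Coord j bp rp → Coord j bq rq → ¬ bp ≡ bq → gram j bp bq rp rq ≡ + 0
gram-off-diagonal j {bp} {rp} {bq} {rq} cp cq bp≢bq with bq ℕ.≟ 2 + bp | bp ℕ.≟ 2 + bq
... | yes refl | _        = gram-two-apart j cp cq
... | no _     | yes refl = trans (gram-sym j bp bq rp rq) (gram-two-apart j cq cp)
... | no ≢₁    | no ≢₂    = sumBelow-zero (2 + j) λ b _ → gramTerm-far j bp bq (no-common b) rp rq
  where
  no-common : ∀ b → ¬ Adjacent b bp ⊎ ¬ Adjacent b bq
  no-common b with adjacent? b bp | adjacent? b bq
  ... | no ¬adj | _       = inj₁ ¬adj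
  ... | yes _   | no ¬adj = inj₂ ¬adj
  ... | yes adj | yes adj′ with common-neighbour adj adj′
  ...   | inj₁ e        = ⊥-elim (bp≢bq e)
  ...   | inj₂ (inj₁ e) = ⊥-elim (≢₁ e)
  ...   | inj₂ (inj₂ e) = ⊥-elim (≢₂ e)

sumBelow-pad : ∀ (f : ℕ → ℤ) → (∀ r → f (2 + r) ≡ + 0) → sumBelow 2 f ≡ sumBelow 4 f
sumBelow-pad f f≡0 = sym (begin
  sumBelow (2 + 2) f                                ≡⟨ sumBelow-+ 2 2 f ⟩
  sumBelow 2 f +ℤ sumBelow 2 (λ r → f (2 + r))
    ≡⟨ cong (sumBelow 2 f +ℤ_) (sumBelow-zero 2 (λ r _ → f≡0 r)) ⟩
  sumBelow 2 f +ℤ + 0                               ≡⟨ ℤ.+-identityʳ _ ⟩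
  sumBelow 2 f                                      ∎)
  where open ≡-Reasoning

-- Summing over all 4j+4 indices is summing over all block coordinates,
-- the two small blocks being padded to size 4 with vanishing terms.
sum-by-blocks : ∀ j (g : ℕ → ℤ) (h : ℕ → ℕ → ℤ) →
  (∀ {b r} → Coord j b r → g (pos b r) ≡ h b r) →
  (∀ r → h 0 (2 + r) ≡ + 0) → (∀ r → h (suc j) (2 + r) ≡ + 0) →
  sumBelow (4 * j + 4) g ≡ sumBelow (2 + j) (λ b → sumBelow 4 (h b))
sum-by-blocks j g h g≡h pad₀ pad₁ = begin
  sumBelow (4 * j + 4) g
    ≡⟨ cong (λ n → sumBelow n g) (size-split j) ⟩
  sumBelow (2 + (4 * j + 2)) g
    ≡⟨ sumBelow-+ 2 (4 * j + 2) g ⟩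
  sumBelow 2 g +ℤ sumBelow (4 * j + 2) (λ i → g (2 + i))
    ≡⟨ cong (sumBelow 2 g +ℤ_) (sumBelow-+ (4 * j) 2 (λ i → g (2 + i))) ⟩
  sumBelow 2 g +ℤ (sumBelow (4 * j) (λ i → g (2 + i)) +ℤ sumBelow 2 (λ r → g (2 + (4 * j + r))))
    ≡⟨ cong₂ _+ℤ_ first-block (cong₂ _+ℤ_ (trans (sumBelow-blocks j 2 g) middle-blocks) last-block) ⟩
  sumBelow 4 (h 0) +ℤ (sumBelow j (λ k → sumBelow 4 (h (suc k))) +ℤ sumBelow 4 (h (suc j)))
    ≡⟨ cong (sumBelow 4 (h 0) +ℤ_) (sym (sumBelow-snoc j (λ k → sumBelow 4 (h (suc k))))) ⟩
  sumBelow (2 + j) (λ b → sumBelow 4 (h b))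
    ∎
  where
  open ≡-Reasoning
  first-block : sumBelow 2 g ≡ sumBelow 4 (h 0)
  first-block = trans (sumBelow-cong 2 (λ r r<2 → g≡h (first r<2))) (sumBelow-pad (h 0) pad₀)
  middle-blocks : sumBelow j (λ k → sumBelow 4 (λ r → g (2 + (4 * k + r))))
                ≡ sumBelow j (λ k → sumBelow 4 (h (suc k)))
  middle-blocks = sumBelow-cong j (λ k k<j → sumBelow-cong 4 (λ r r<4 → g≡h (middle k<j r<4)))
  last-block : sumBelow 2 (λ r → g (2 + (4 * j + r))) ≡ sumBelow 4 (h (suc j))
  last-block = trans (sumBelow-cong 2 (λ r r<2 → g≡h (last r<2))) (sumBelow-pad (h (suc j)) pad₁)

-- A has only two rows and D only two columns, so the padding rows of the
-- first and last block rows of S vanish.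

blockS-first-pad : ∀ j r b′ r′ → blockS j 0 b′ (2 + r) r′ ≡ + 0
blockS-first-pad j r b′ r′ with b′ ≡ᵇ 1
... | true  = refl
... | false = refl

Dmat-pad : ∀ r c → Dmat r (2 + c) ≡ + 0
Dmat-pad 0 c = refl
Dmat-pad 1 c = refl
Dmat-pad 2 c = refl
Dmat-pad 3 c = refl
Dmat-pad (suc (suc (suc (suc r)))) c = refl

blockS-last-pad : ∀ j → 1 ≤ j → ∀ r {b′ r′} → Coord j b′ r′ →
  blockS j (suc j) b′ (2 + r) r′ ≡ + 0
blockS-last-pad j 1≤j r {b′} {r′} c′ with b′ ℕ.≟ j
... | yes refl = begin
  blockS j (suc j) j (2 + r) r′   ≡⟨ blockS-sub j j (2 + r) r′ ⟩
  - upper j j r′ (2 + r)          ≡⟨ cong -_ (upper-last j 1≤j r′ (2 + r)) ⟩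
  - Dmat r′ (2 + r)               ≡⟨ cong -_ (Dmat-pad r′ r) ⟩
  + 0                             ∎
  where open ≡-Reasoning
... | no b′≢j = blockS-far j not-adjacent (2 + r) r′
  where
  not-adjacent : ¬ Adjacent (suc j) b′
  not-adjacent (inj₁ refl) = ℕ.<-irrefl refl (coord-block< c′)
  not-adjacent (inj₂ e)    = b′≢j (sym (ℕ.suc-injective e))

SᵀS≡gram : ∀ j → 1 ≤ j → (p q : Fin (4 * j + 4)) → ∀ {bp rp bq rq} →
  Coord j bp rp → pos bp rp ≡ toℕ p → Coord j bq rq → pos bq rq ≡ toℕ q →
  (transpose (Smat j) · Smat j) p q ≡ gram j bp bq rp rq
SᵀS≡gram j 1≤j p q {bp} {rp} {bq} {rq} cp ep cq eq =
  trans (sumFin≡sumBelow (4 * j + 4) (λ l → Sℕ j l (toℕ p) *ℤ Sℕ j l (toℕ q)))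
        (sum-by-blocks j _ entry in-blocks pad-first pad-last)
  where
  entry : ℕ → ℕ → ℤ
  entry b t = blockS j b bp t rp *ℤ blockS j b bq t rq
  in-blocks : ∀ {b t} → Coord j b t → Sℕ j (pos b t) (toℕ p) *ℤ Sℕ j (pos b t) (toℕ q) ≡ entry b t
  in-blocks c rewrite sym ep | sym eq = cong₂ _*ℤ_ (S-pos c cp) (S-pos c cq)
  pad-first : ∀ r → entry 0 (2 + r) ≡ + 0
  pad-first r = cong (_*ℤ blockS j 0 bq (2 + r) rq) (blockS-first-pad j r bp rp)
  pad-last : ∀ r → entry (suc j) (2 + r) ≡ + 0
  pad-last r = cong (_*ℤ blockS j (suc j) bq (2 + r) rq) (blockS-last-pad j 1≤j r cp)

δ4-diagonal : ∀ r → δ4 r r ≡ + 4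
δ4-diagonal r = cong (λ x → if x then + 4 else + 0) (≡ᵇ-refl r)

δ4-off-diagonal : ∀ {r c} → ¬ r ≡ c → δ4 r c ≡ + 0
δ4-off-diagonal r≢c = cong (λ x → if x then + 4 else + 0) (≡ᵇ-≢ r≢c)

-- SᵀS = 4I.  Matching on p ≟ q also evaluates the entry of the identity.
SᵀS≡4I : ∀ j → 1 ≤ j → ∀ p q → (transpose (Smat j) · Smat j) p q ≡ scale (+ 4) identity p q
SᵀS≡4I j 1≤j p q with p Fin.≟ q | coordOfFin j p | coordOfFin j q
... | yes refl | b , r , c , e | _ = begin
  (transpose (Smat j) · Smat j) p p   ≡⟨ SᵀS≡gram j 1≤j p p c e c e ⟩
  gram j b b r r                      ≡⟨ gram-diagonal j 1≤j c c ⟩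
  δ4 r r                              ≡⟨ δ4-diagonal r ⟩
  + 4                                 ∎
  where open ≡-Reasoning
... | no p≢q | bp , rp , cp , ep | bq , rq , cq , eq =
  trans (SᵀS≡gram j 1≤j p q cp ep cq eq) gram≡0
  where
  gram≡0 : gram j bp bq rp rq ≡ + 0
  gram≡0 with bp ℕ.≟ bq | rp ℕ.≟ rq
  ... | no bp≢bq | _        = gram-off-diagonal j cp cq bp≢bq
  ... | yes refl | no rp≢rq = trans (gram-diagonal j 1≤j cp cq) (δ4-off-diagonal rp≢rq)
  ... | yes refl | yes refl = ⊥-elim (p≢q (Fin.toℕ-injective (trans (sym ep) eq)))

-- The 1-based index 2k+1+e of the e-th vertex (e < 2) in the k-th pair
-- {u_{2k+1}, u_{2k+2}} or {v_{2k+1}, v_{2k+2}}.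
pairIndex : ℕ → ℕ → ℕ
pairIndex k e = suc (2 * k + e)

-- Offsets inside a block of size 4: the u-pair at offsets 0, 1 and the
-- v-pair at offsets 2, 3.
data Offset : ℕ → Set where
  u-side : ∀ {e} → e < 2 → Offset e
  v-side : ∀ {e} → e < 2 → Offset (2 + e)

offset : ∀ {r} → r < 4 → Offset r
offset {0}             _ = u-side (s≤s z≤n)
offset {1}             _ = u-side (s≤s (s≤s z≤n))
offset {2}             _ = v-side (s≤s z≤n)
offset {3}             _ = v-side (s≤s (s≤s z≤n))
offset {suc (suc (suc (suc _)))} (s≤s (s≤s (s≤s (s≤s ()))))

quad : ℕ → ℕ → HV
quad k 0 = U (2 * k + 1)
quad k 1 = U (2 * k + 2)
quad k 2 = V (2 * k + 1)
quad k _ = V (2 * k + 2)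

-- Index arithmetic converting the forms used in Defs into pairIndex
-- (the right-hand sides are pairIndex unfolded, as the solver needs).

first-index : ∀ k → 2 * k + 1 ≡ suc (2 * k + 0)
first-index = solve-∀

second-index : ∀ k → 2 * k + 2 ≡ suc (2 * k + 1)
second-index = solve-∀

tail-index : ∀ k e → 2 * k + 1 + e ≡ suc (2 * k + e)
tail-index = solve-∀

head-index : ∀ k e → 2 * k + 3 + e ≡ suc (2 * suc k + e)
head-index = solve-∀

-- 2(k+1) ∸ 1 + e, the index of v_{2j-1+e} for j = k+1, computes to the left-hand side.
last-tail-index : ∀ k e → k + suc (k + 0) + e ≡ suc (2 * k + e)
last-tail-index = solve-∀

2[1+j]≡2j+2 : ∀ j → 2 * suc j ≡ 2 * j + 2
2[1+j]≡2j+2 = solve-∀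

quad-u : ∀ k {e} → e < 2 → quad k e ≡ U (pairIndex k e)
quad-u k (s≤s z≤n)       = cong U (first-index k)
quad-u k (s≤s (s≤s z≤n)) = cong U (second-index k)

quad-v : ∀ k {e} → e < 2 → quad k (2 + e) ≡ V (pairIndex k e)
quad-v k (s≤s z≤n)       = cong V (first-index k)
quad-v k (s≤s (s≤s z≤n)) = cong V (second-index k)

vertexAt : ℕ → ℕ → ℕ → HV
vertexAt j zero    zero    = hu
vertexAt j zero    (suc _) = hv
vertexAt j (suc k) r       = if k <ᵇ j then quad k r else U (2 * j + 1 + r)

vertexAt-middle : ∀ j {k} r → k < j → vertexAt j (suc k) r ≡ quad k r
vertexAt-middle j r k<j rewrite <ᵇ-< k<j = refl

vertexAt-last : ∀ j r → vertexAt j (suc j) r ≡ U (pairIndex j r)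
vertexAt-last j r rewrite <ᵇ-≥ {j} {j} ℕ.≤-refl = cong U (tail-index j r)

label-pos : ∀ j {b r} → Coord j b r → labelℕ j (pos b r) ≡ vertexAt j b r
label-pos j (first (s≤s z≤n))       = refl
label-pos j (first (s≤s (s≤s z≤n))) = refl
label-pos j (middle {k} {0} k<j r<4)
  rewrite <ᵇ-< (middle-pos< j k 0 k<j r<4) | [nk+r]/n≡k 4 k 0 r<4 | [nk+r]%n≡r 4 k 0 r<4 | <ᵇ-< k<j = refl
label-pos j (middle {k} {1} k<j r<4)
  rewrite <ᵇ-< (middle-pos< j k 1 k<j r<4) | [nk+r]/n≡k 4 k 1 r<4 | [nk+r]%n≡r 4 k 1 r<4 | <ᵇ-< k<j = refl
label-pos j (middle {k} {2} k<j r<4)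
  rewrite <ᵇ-< (middle-pos< j k 2 k<j r<4) | [nk+r]/n≡k 4 k 2 r<4 | [nk+r]%n≡r 4 k 2 r<4 | <ᵇ-< k<j = refl
label-pos j (middle {k} {3} k<j r<4)
  rewrite <ᵇ-< (middle-pos< j k 3 k<j r<4) | [nk+r]/n≡k 4 k 3 r<4 | [nk+r]%n≡r 4 k 3 r<4 | <ᵇ-< k<j = refl
label-pos j (middle {r = suc (suc (suc (suc _)))} _ (s≤s (s≤s (s≤s (s≤s ())))))
label-pos j (last {r} _) rewrite <ᵇ-≥ (last-pos≥ j r) | last-pos∸ j r | <ᵇ-≥ {j} {j} ℕ.≤-refl = refl

coordOfVertex : HV → ℕ × ℕ
coordOfVertex hu    = 0 , 0
coordOfVertex hv    = 0 , 1
coordOfVertex (U a) = suc ((a ∸ 1) / 2) , (a ∸ 1) % 2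
coordOfVertex (V a) = suc ((a ∸ 1) / 2) , 2 + (a ∸ 1) % 2

coordOf-U : ∀ k {e} → e < 2 → coordOfVertex (U (pairIndex k e)) ≡ (suc k , e)
coordOf-U k {e} e<2 rewrite [nk+r]/n≡k 2 k e e<2 | [nk+r]%n≡r 2 k e e<2 = refl

coordOf-V : ∀ k {e} → e < 2 → coordOfVertex (V (pairIndex k e)) ≡ (suc k , 2 + e)
coordOf-V k {e} e<2 rewrite [nk+r]/n≡k 2 k e e<2 | [nk+r]%n≡r 2 k e e<2 = refl

coordOfVertex-vertexAt : ∀ j {b r} → Coord j b r → coordOfVertex (vertexAt j b r) ≡ (b , r)
coordOfVertex-vertexAt j (first (s≤s z≤n))       = refl
coordOfVertex-vertexAt j (first (s≤s (s≤s z≤n))) = refl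
coordOfVertex-vertexAt j (middle {k} {r} k<j r<4) rewrite vertexAt-middle j r k<j with offset r<4
... | u-side e<2 rewrite quad-u k e<2 = coordOf-U k e<2
... | v-side e<2 rewrite quad-v k e<2 = coordOf-V k e<2
coordOfVertex-vertexAt j (last {r} r<2) rewrite vertexAt-last j r = coordOf-U j r<2

vertexAt-injective : ∀ j {b r b′ r′} → Coord j b r → Coord j b′ r′ →
  vertexAt j b r ≡ vertexAt j b′ r′ → b ≡ b′ × r ≡ r′
vertexAt-injective j c c′ same = cong proj₁ coords≡ , cong proj₂ coords≡
  where
  coords≡ = trans (sym (coordOfVertex-vertexAt j c)) (trans (cong coordOfVertex same) (coordOfVertex-vertexAt j c′))

pairIndex≤ : ∀ {k m e} → k < m → e < 2 → pairIndex k e ≤ 2 * m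
pairIndex≤ {k} {m} {e} k<m e<2 = begin
  suc (2 * k + e)   ≤⟨ ℕ.+-monoʳ-< (2 * k) e<2 ⟩
  2 * k + 2         ≡⟨ trans (+-comm (2 * k) 2) (sym (*-suc 2 k)) ⟩
  2 * suc k         ≤⟨ ℕ.*-monoʳ-≤ 2 k<m ⟩
  2 * m             ∎
  where open ℕ.≤-Reasoning

vertexAt-isVertex : ∀ j {b r} → Coord j b r → IsVertex j (vertexAt j b r)
vertexAt-isVertex j (first (s≤s z≤n))       = isu
vertexAt-isVertex j (first (s≤s (s≤s z≤n))) = isv
vertexAt-isVertex j (middle {k} {r} k<j r<4) rewrite vertexAt-middle j r k<j with offset r<4
... | u-side e<2 rewrite quad-u k e<2 = isU (s≤s z≤n) (ℕ.≤-trans (pairIndex≤ k<j e<2) (ℕ.m≤m+n (2 * j) 2))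
... | v-side e<2 rewrite quad-v k e<2 = isV (s≤s z≤n) (pairIndex≤ k<j e<2)
vertexAt-isVertex j (last {r} r<2) rewrite vertexAt-last j r =
  isU (s≤s z≤n) (subst (pairIndex j r ≤_) (2[1+j]≡2j+2 j) (pairIndex≤ (ℕ.n<1+n j) r<2))

pairOf : ∀ a → Σ ℕ λ k → Σ ℕ λ e → e < 2 × pairIndex k e ≡ suc a
pairOf a = a / 2 , a % 2 , m%n<n a 2 , cong suc (m≡n[m/n]+m%n a 2)

pairIndex≤⇒< : ∀ {k e m} → pairIndex k e ≤ 2 * m → k < m
pairIndex≤⇒< {k} {e} {m} le = ℕ.*-cancelˡ-< 2 k m (ℕ.≤-<-trans (ℕ.m≤m+n (2 * k) e) le)

vertexAt-surjective : ∀ j {x} → IsVertex j x → Σ ℕ λ b → Σ ℕ λ r → Coord j b r × vertexAt j b r ≡ x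
vertexAt-surjective j isu = 0 , 0 , first (s≤s z≤n) , refl
vertexAt-surjective j isv = 0 , 1 , first (s≤s (s≤s z≤n)) , refl
vertexAt-surjective j (isU {suc a} _ a≤) with pairOf a
... | k , e , e<2 , refl = u-vertex (k ℕ.<? j)
  where
  u-vertex : Dec (k < j) → Σ ℕ λ b → Σ ℕ λ r → Coord j b r × vertexAt j b r ≡ U (pairIndex k e)
  u-vertex (yes k<j) = suc k , e , middle k<j (<2⇒<4 e<2) , trans (vertexAt-middle j e k<j) (quad-u k e<2)
  u-vertex (no k≮j)  = suc j , e , last e<2 , trans (vertexAt-last j e) (cong (λ m → U (pairIndex m e)) (sym k≡j))
    where
    k≡j : k ≡ j
    k≡j = ℕ.≤-antisym (s≤s⁻¹ (pairIndex≤⇒< (subst (pairIndex k e ≤_) (sym (2[1+j]≡2j+2 j)) a≤)))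
                      (ℕ.≮⇒≥ k≮j)
vertexAt-surjective j (isV {suc a} _ a≤) with pairOf a
... | k , e , e<2 , refl = suc k , 2 + e , middle k<j (s≤s (s≤s e<2)) ,
      trans (vertexAt-middle j (2 + e) k<j) (quad-v k e<2)
  where k<j = pairIndex≤⇒< a≤

A-nonzero : ∀ {r c} → r < 2 → c < 4 → ¬ Amat r c ≡ + 0
A-nonzero = decideGrid (λ r c → ¬? (Amat r c ℤ.≟ + 0)) 2 4

D-nonzero : ∀ {r c} → r < 4 → c < 2 → ¬ Dmat r c ≡ + 0
D-nonzero = decideGrid (λ r c → ¬? (Dmat r c ℤ.≟ + 0)) 4 2

B-nonzero-uu : ∀ {e e′} → e < 2 → e′ < 2 → ¬ Bmat e e′ ≡ + 0
B-nonzero-uu = decideGrid (λ r c → ¬? (Bmat r c ℤ.≟ + 0)) 2 2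

B-nonzero-vv : ∀ {e e′} → e < 2 → e′ < 2 → ¬ Bmat (2 + e) (2 + e′) ≡ + 0
B-nonzero-vv = decideGrid (λ r c → ¬? (Bmat (2 + r) (2 + c) ℤ.≟ + 0)) 2 2

B-zero-uv : ∀ {e e′} → e < 2 → e′ < 2 → Bmat e (2 + e′) ≡ + 0
B-zero-uv = decideGrid (λ r c → Bmat r (2 + c) ℤ.≟ + 0) 2 2

B-zero-vu : ∀ {e e′} → e < 2 → e′ < 2 → Bmat (2 + e) e′ ≡ + 0
B-zero-vu = decideGrid (λ r c → Bmat (2 + r) c ℤ.≟ + 0) 2 2

uu-edge : ∀ {j} k {e e′} → suc k ≤ j → e < 2 → e′ < 2 →
  Base j (U (pairIndex k e)) (U (pairIndex (suc k) e′))
uu-edge {j} k {e} {e′} k<j e<2 e′<2 =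
  subst₂ (λ x y → Base j (U x) (U y)) (tail-index k e) (head-index k e′)
    (UU k<j (s≤s⁻¹ e<2) (s≤s⁻¹ e′<2))

vv-edge : ∀ {j} k {e e′} → suc (suc k) ≤ j → e < 2 → e′ < 2 →
  Base j (V (pairIndex k e)) (V (pairIndex (suc k) e′))
vv-edge {j} k {e} {e′} k+1<j e<2 e′<2 =
  subst₂ (λ x y → Base j (V x) (V y)) (tail-index k e) (head-index k e′)
    (VV k+1<j (s≤s⁻¹ e<2) (s≤s⁻¹ e′<2))

vu-edge : ∀ k {e e′} → e < 2 → e′ < 2 →
  Base (suc k) (V (pairIndex k e)) (U (pairIndex (suc k) e′))
vu-edge k {e} {e′} e<2 e′<2 =
  subst₂ (λ x y → Base (suc k) (V x) (U y)) (last-tail-index k e) (tail-index (suc k) e′)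
    (VU (s≤s⁻¹ e<2) (s≤s⁻¹ e′<2))

nonzero⇒edge : ∀ j → 1 ≤ j → ∀ {b r r′} → Coord j b r → Coord j (suc b) r′ →
  ¬ upper j b r r′ ≡ + 0 → Base j (vertexAt j b r) (vertexAt j (suc b) r′)
nonzero⇒edge j _ (first r<2) (middle {r = r′} 0<j r′<4) _
  rewrite vertexAt-middle j r′ 0<j = from-first r<2 (offset r′<4)
  where
  from-first : ∀ {r r′} → r < 2 → Offset r′ → Base j (vertexAt j 0 r) (quad 0 r′)
  from-first (s≤s z≤n)       (u-side e<2) rewrite quad-u 0 e<2 = uU (s≤s⁻¹ e<2)
  from-first (s≤s z≤n)       (v-side e<2) rewrite quad-v 0 e<2 = uV (s≤s⁻¹ e<2)
  from-first (s≤s (s≤s z≤n)) (u-side e<2) rewrite quad-u 0 e<2 = vU (s≤s⁻¹ e<2)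
  from-first (s≤s (s≤s z≤n)) (v-side e<2) rewrite quad-v 0 e<2 = vV (s≤s⁻¹ e<2)
nonzero⇒edge .0 () (first _) (last _) _
nonzero⇒edge j _ (middle {k} {r} k<j r<4) (middle {r = r′} k+1<j r′<4) nonzero
  rewrite vertexAt-middle j r k<j | vertexAt-middle j r′ k+1<j | upper-middle j k (λ e → ℕ.<-irrefl e k+1<j) r r′
  with offset r<4 | offset r′<4
... | u-side e<2 | u-side e′<2 rewrite quad-u k e<2 | quad-u (suc k) e′<2 = uu-edge k k<j e<2 e′<2
... | v-side e<2 | v-side e′<2 rewrite quad-v k e<2 | quad-v (suc k) e′<2 = vv-edge k k+1<j e<2 e′<2
... | u-side e<2 | v-side e′<2 = ⊥-elim (nonzero (B-zero-uv e<2 e′<2))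
... | v-side e<2 | u-side e′<2 = ⊥-elim (nonzero (B-zero-vu e<2 e′<2))
nonzero⇒edge .(suc k) _ (middle {k} {r} k<j r<4) (last {r′} r′<2) _
  rewrite vertexAt-middle (suc k) r k<j | vertexAt-last (suc k) r′ with offset r<4
... | u-side e<2 rewrite quad-u k e<2 = uu-edge k k<j e<2 r′<2
... | v-side e<2 rewrite quad-v k e<2 = vu-edge k e<2 r′<2
nonzero⇒edge j _ (last _) c′ _ = ⊥-elim (ℕ.<-irrefl refl (coord-block< c′))

record BlockEdge (j : ℕ) (x y : HV) : Set where
  constructor blockEdge
  field
    {b r r′} : ℕ
    tail     : Coord j b r
    head     : Coord j (suc b) r′
    tail≡    : vertexAt j b r ≡ x
    head≡    : vertexAt j (suc b) r′ ≡ y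
    nonzero  : ¬ upper j b r r′ ≡ + 0

nonzero-cong : ∀ {x y : ℤ} → x ≡ y → ¬ y ≡ + 0 → ¬ x ≡ + 0
nonzero-cong x≡y y≢0 x≡0 = y≢0 (trans (sym x≡y) x≡0)

u<4 : ∀ {e} → e ≤ 1 → e < 4
u<4 e≤1 = <2⇒<4 (s≤s e≤1)

v<4 : ∀ {e} → e ≤ 1 → 2 + e < 4
v<4 e≤1 = s≤s (s≤s (s≤s e≤1))

-- The vertices of the middle blocks, with indices as they occur in Base.

u-tail : ∀ j {k a} → k < j → a ≤ 1 → vertexAt j (suc k) a ≡ U (2 * k + 1 + a)
u-tail j {k} {a} k<j a≤1 =
  trans (vertexAt-middle j a k<j) (trans (quad-u k (s≤s a≤1)) (cong U (sym (tail-index k a))))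

v-tail : ∀ j {k a} → k < j → a ≤ 1 → vertexAt j (suc k) (2 + a) ≡ V (2 * k + 1 + a)
v-tail j {k} {a} k<j a≤1 =
  trans (vertexAt-middle j (2 + a) k<j) (trans (quad-v k (s≤s a≤1)) (cong V (sym (tail-index k a))))

u-head : ∀ j {k b} → suc k < j → b ≤ 1 → vertexAt j (suc (suc k)) b ≡ U (2 * k + 3 + b)
u-head j {k} {b} k+1<j b≤1 =
  trans (vertexAt-middle j b k+1<j) (trans (quad-u (suc k) (s≤s b≤1)) (cong U (sym (head-index k b))))

v-head : ∀ j {k b} → suc k < j → b ≤ 1 → vertexAt j (suc (suc k)) (2 + b) ≡ V (2 * k + 3 + b)
v-head j {k} {b} k+1<j b≤1 =
  trans (vertexAt-middle j (2 + b) k+1<j) (trans (quad-v (suc k) (s≤s b≤1)) (cong V (sym (head-index k b))))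

-- (Stated for H_{j+1}, so that the first middle block exists.)
edge⇒block : ∀ j {x y} → Base (suc j) x y → BlockEdge (suc j) x y
edge⇒block j (uU x≤1) = blockEdge (first (s≤s z≤n)) (middle (s≤s z≤n) (u<4 x≤1)) refl
  (quad-u 0 (s≤s x≤1)) (A-nonzero (s≤s z≤n) (u<4 x≤1))
edge⇒block j (uV x≤1) = blockEdge (first (s≤s z≤n)) (middle (s≤s z≤n) (v<4 x≤1)) refl
  (quad-v 0 (s≤s x≤1)) (A-nonzero (s≤s z≤n) (v<4 x≤1))
edge⇒block j (vU x≤1) = blockEdge (first (s≤s (s≤s z≤n))) (middle (s≤s z≤n) (u<4 x≤1)) refl
  (quad-u 0 (s≤s x≤1)) (A-nonzero (s≤s (s≤s z≤n)) (u<4 x≤1))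
edge⇒block j (vV x≤1) = blockEdge (first (s≤s (s≤s z≤n))) (middle (s≤s z≤n) (v<4 x≤1)) refl
  (quad-v 0 (s≤s x≤1)) (A-nonzero (s≤s (s≤s z≤n)) (v<4 x≤1))
edge⇒block j (UU {k} {a} {b} k<1+j a≤1 b≤1) with k ℕ.≟ j
... | yes refl = blockEdge (middle k<1+j (u<4 a≤1)) (last (s≤s b≤1))
  (u-tail (suc k) k<1+j a≤1) (trans (vertexAt-last (suc k) b) (cong U (sym (head-index k b))))
  (nonzero-cong (upper-last (suc k) (s≤s z≤n) a b) (D-nonzero (u<4 a≤1) (s≤s b≤1)))
... | no k≢j   = blockEdge (middle k<1+j (u<4 a≤1)) (middle k+1<1+j (u<4 b≤1))
  (u-tail (suc j) k<1+j a≤1) (u-head (suc j) k+1<1+j b≤1)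
  (nonzero-cong (upper-middle (suc j) k (ℕ.<⇒≢ k+1<1+j) a b) (B-nonzero-uu (s≤s a≤1) (s≤s b≤1)))
  where k+1<1+j = s≤s (ℕ.≤∧≢⇒< (s≤s⁻¹ k<1+j) k≢j)
edge⇒block j (VV {k} {a} {b} k+1<1+j a≤1 b≤1) =
  blockEdge (middle (ℕ.<-trans (ℕ.n<1+n k) k+1<1+j) (v<4 a≤1)) (middle k+1<1+j (v<4 b≤1))
  (v-tail (suc j) (ℕ.<-trans (ℕ.n<1+n k) k+1<1+j) a≤1) (v-head (suc j) k+1<1+j b≤1)
  (nonzero-cong (upper-middle (suc j) k (ℕ.<⇒≢ k+1<1+j) (2 + a) (2 + b)) (B-nonzero-vv (s≤s a≤1) (s≤s b≤1)))
edge⇒block j (VU {a} {b} a≤1 b≤1) =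
  blockEdge (middle (ℕ.n<1+n j) (v<4 a≤1)) (last (s≤s b≤1))
  (trans (vertexAt-middle (suc j) (2 + a) (ℕ.n<1+n j))
         (trans (quad-v j (s≤s a≤1)) (cong V (sym (last-tail-index j a)))))
  (trans (vertexAt-last (suc j) b) (cong U (sym (tail-index (suc j) b))))
  (nonzero-cong (upper-last (suc j) (s≤s z≤n) (2 + a) b) (D-nonzero (v<4 a≤1) (s≤s b≤1)))

edge⇒nonzero : ∀ j → 1 ≤ j → ∀ {b r b′ r′} → Coord j b r → Coord j b′ r′ →
  Base j (vertexAt j b r) (vertexAt j b′ r′) → ¬ blockS j b b′ r r′ ≡ + 0
edge⇒nonzero (suc j) _ {b} {r} c c′ edge with edge⇒block j edge
... | blockEdge tail head tail≡ head≡ nonzero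
  with vertexAt-injective (suc j) c tail (sym tail≡) | vertexAt-injective (suc j) c′ head (sym head≡)
... | refl , refl | refl , refl = nonzero-cong (blockS-super (suc j) b r _) nonzero

adjacent⇒nonzero : ∀ j → 1 ≤ j → ∀ {b r b′ r′} → Coord j b r → Coord j b′ r′ →
  HAdj j (vertexAt j b r) (vertexAt j b′ r′) → ¬ blockS j b b′ r r′ ≡ + 0
adjacent⇒nonzero j 1≤j c c′ (inj₁ edge) = edge⇒nonzero j 1≤j c c′ edge
adjacent⇒nonzero j 1≤j {b} {r} {b′} {r′} c c′ (inj₂ edge) S≡0 =
  edge⇒nonzero j 1≤j c′ c edge (trans (blockS-anti j b r b′ r′) (cong -_ S≡0))

nonzero⇒adjacent : ∀ j → 1 ≤ j → ∀ {b r b′ r′} → Coord j b r → Coord j b′ r′ →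
  ¬ blockS j b b′ r r′ ≡ + 0 → HAdj j (vertexAt j b r) (vertexAt j b′ r′)
nonzero⇒adjacent j 1≤j {b} {r} {b′} {r′} c c′ S≢0 with adjacent? b b′
... | yes (inj₁ refl) = inj₁ (nonzero⇒edge j 1≤j c c′ (nonzero-cong (sym (blockS-super j b r r′)) S≢0))
... | yes (inj₂ refl) =
  inj₂ (nonzero⇒edge j 1≤j c′ c λ X≡0 → S≢0 (trans (blockS-sub j b′ r r′) (cong -_ X≡0)))
... | no ¬adj         = ⊥-elim (S≢0 (blockS-far j ¬adj r r′))

Ternary : ℤ → Set
Ternary z = z ≡ + 1 ⊎ z ≡ - + 1 ⊎ z ≡ + 0

ternary? : ∀ z → Dec (Ternary z)
ternary? z = z ℤ.≟ + 1 ⊎-dec z ℤ.≟ - + 1 ⊎-dec z ℤ.≟ + 0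

ternary-neg : ∀ {z} → Ternary z → Ternary (- z)
ternary-neg (inj₁ refl)        = inj₂ (inj₁ refl)
ternary-neg (inj₂ (inj₁ refl)) = inj₁ refl
ternary-neg (inj₂ (inj₂ refl)) = inj₂ (inj₂ refl)

1≢0 : ¬ + 1 ≡ + 0
1≢0 ()

-1≢1 : ¬ - + 1 ≡ + 1
-1≢1 ()

0≢1 : ¬ + 0 ≡ + 1
0≢1 ()

does-sound : ∀ {A : Set} (a? : Dec A) → does a? ≡ true → A
does-sound (yes a) _ = a

-- A skew-symmetric matrix with entries in {0, ±1} whose nonzero entries are
-- exactly the adjacent pairs of a graph is the skew-adjacency matrix of the
-- orientation that directs each edge towards its +1 entry.
skew-orientation : ∀ {n} (Adj : Fin n → Fin n → Set) (M : Matrix n) →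
  (∀ p q → Ternary (M p q)) → (∀ p q → M q p ≡ - M p q) →
  (∀ p q → ¬ M p q ≡ + 0 → Adj p q) → (∀ p q → Adj p q → ¬ M p q ≡ + 0) →
  Σ (Fin n → Fin n → Bool) λ σ → IsOrientation Adj σ × (∀ p q → M p q ≡ skewAdj σ p q)
skew-orientation {n} Adj M ternary skew nonzero⇒adj adj⇒nonzero =
  σ , (arc⇒adj , one-way , adj⇒arc) , M≡skewAdj
  where
  σ : Fin n → Fin n → Bool
  σ p q = does (M p q ℤ.≟ + 1)

  arc : ∀ {p q} → M p q ≡ + 1 → σ p q ≡ true
  arc {p} {q} = dec-true (M p q ℤ.≟ + 1)

  no-arc : ∀ {p q} → ¬ M p q ≡ + 1 → σ p q ≡ false
  no-arc {p} {q} = dec-false (M p q ℤ.≟ + 1)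

  arc⇒one : ∀ {p q} → σ p q ≡ true → M p q ≡ + 1
  arc⇒one {p} {q} = does-sound (M p q ℤ.≟ + 1)

  reverse-of-one : ∀ {p q} → M p q ≡ + 1 → M q p ≡ - + 1
  reverse-of-one {p} {q} M≡1 = trans (skew p q) (cong -_ M≡1)

  arc⇒adj : ∀ p q → σ p q ≡ true → Adj p q
  arc⇒adj p q σ≡true = nonzero⇒adj p q (λ M≡0 → 1≢0 (trans (sym (arc⇒one σ≡true)) M≡0))

  one-way : ∀ p q → σ p q ≡ true → σ q p ≡ false
  one-way p q σ≡true = no-arc (λ M≡1 → -1≢1 (trans (sym (reverse-of-one (arc⇒one σ≡true))) M≡1))

  adj⇒arc : ∀ p q → Adj p q → σ p q ≡ true ⊎ σ q p ≡ true
  adj⇒arc p q adj with ternary p q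
  ... | inj₁ M≡1         = inj₁ (arc M≡1)
  ... | inj₂ (inj₁ M≡-1) = inj₂ (arc (trans (skew p q) (cong -_ M≡-1)))
  ... | inj₂ (inj₂ M≡0)  = ⊥-elim (adj⇒nonzero p q adj M≡0)

  M≡skewAdj : ∀ p q → M p q ≡ skewAdj σ p q
  M≡skewAdj p q with ternary p q
  ... | inj₁ M≡1 rewrite arc M≡1 = M≡1
  ... | inj₂ (inj₁ M≡-1)
    rewrite no-arc {p} {q} (λ M≡1 → -1≢1 (trans (sym M≡-1) M≡1))
          | arc (trans (skew p q) (cong -_ M≡-1)) = M≡-1
  ... | inj₂ (inj₂ M≡0)
    rewrite no-arc {p} {q} (λ M≡1 → 0≢1 (trans (sym M≡0) M≡1))
          | no-arc {q} {p} (λ M≡1 → 0≢1 (trans (sym (trans (skew p q) (cong -_ M≡0))) M≡1)) = M≡0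

upper-ternary : ∀ j b {r c} → r < 4 → c < 4 → Ternary (upper j b r c)
upper-ternary j b with b ≡ᵇ 0 | b ≡ᵇ j
... | true  | _     = decideGrid (λ r c → ternary? (Amat r c)) 4 4
... | false | true  = decideGrid (λ r c → ternary? (Dmat r c)) 4 4
... | false | false = decideGrid (λ r c → ternary? (Bmat r c)) 4 4

blockS-ternary : ∀ j b b′ {r r′} → r < 4 → r′ < 4 → Ternary (blockS j b b′ r r′)
blockS-ternary j b b′ {r} {r′} r<4 r′<4 with adjacent? b b′
... | yes (inj₁ refl) = subst Ternary (sym (blockS-super j b r r′)) (upper-ternary j b r<4 r′<4)
... | yes (inj₂ refl) = subst Ternary (sym (blockS-sub j b′ r r′)) (ternary-neg (upper-ternary j b′ r′<4 r<4))
... | no ¬adj         = inj₂ (inj₂ (blockS-far j ¬adj r r′))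

module Indices (j : ℕ) where

  label-coord : ∀ {p b r} → pos b r ≡ toℕ p → Coord j b r → label j p ≡ vertexAt j b r
  label-coord e c = trans (cong (labelℕ j) (sym e)) (label-pos j c)

  Smat-coord : ∀ {p q bp rp bq rq} → pos bp rp ≡ toℕ p → pos bq rq ≡ toℕ q →
    Coord j bp rp → Coord j bq rq → Smat j p q ≡ blockS j bp bq rp rq
  Smat-coord ep eq cp cq = trans (cong₂ (Sℕ j) (sym ep) (sym eq)) (S-pos cp cq)

  label-isVertex : ∀ p → IsVertex j (label j p)
  label-isVertex p with coordOfFin j p
  ... | b , r , c , e = subst (IsVertex j) (sym (label-coord e c)) (vertexAt-isVertex j c)

  label-injective : ∀ p q → label j p ≡ label j q → p ≡ q
  label-injective p q same with coordOfFin j p | coordOfFin j q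
  ... | bp , rp , cp , ep | bq , rq , cq , eq
    with vertexAt-injective j cp cq (trans (sym (label-coord ep cp)) (trans same (label-coord eq cq)))
  ... | refl , refl = Fin.toℕ-injective (trans (sym ep) eq)

  label-surjective : ∀ x → IsVertex j x → ∃ λ p → label j p ≡ x
  label-surjective x x∈V with vertexAt-surjective j x∈V
  ... | b , r , c , refl = fromℕ< (pos<size c) , label-coord (sym (Fin.toℕ-fromℕ< (pos<size c))) c

  Smat-ternary : ∀ p q → Ternary (Smat j p q)
  Smat-ternary p q with coordOfFin j p | coordOfFin j q
  ... | bp , rp , cp , ep | bq , rq , cq , eq =
    subst Ternary (sym (Smat-coord ep eq cp cq)) (blockS-ternary j bp bq (coord-offset< cp) (coord-offset< cq))

  Smat-skew : ∀ p q → Smat j q p ≡ - Smat j p q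
  Smat-skew p q with coordOfFin j p | coordOfFin j q
  ... | bp , rp , cp , ep | bq , rq , cq , eq = begin
    Smat j q p                  ≡⟨ Smat-coord eq ep cq cp ⟩
    blockS j bq bp rq rp        ≡⟨ blockS-anti j bp rp bq rq ⟩
    - blockS j bp bq rp rq      ≡⟨ cong -_ (Smat-coord ep eq cp cq) ⟨
    - Smat j p q                ∎
    where open ≡-Reasoning

  nonzero⇒HAdjFin : 1 ≤ j → ∀ p q → ¬ Smat j p q ≡ + 0 → HAdjFin j p q
  nonzero⇒HAdjFin 1≤j p q S≢0 with coordOfFin j p | coordOfFin j q
  ... | bp , rp , cp , ep | bq , rq , cq , eq =
    subst₂ (HAdj j) (sym (label-coord ep cp)) (sym (label-coord eq cq))
      (nonzero⇒adjacent j 1≤j cp cq (nonzero-cong (sym (Smat-coord ep eq cp cq)) S≢0))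

  HAdjFin⇒nonzero : 1 ≤ j → ∀ p q → HAdjFin j p q → ¬ Smat j p q ≡ + 0
  HAdjFin⇒nonzero 1≤j p q adj with coordOfFin j p | coordOfFin j q
  ... | bp , rp , cp , ep | bq , rq , cq , eq =
    nonzero-cong (Smat-coord ep eq cp cq)
      (adjacent⇒nonzero j 1≤j cp cq (subst₂ (HAdj j) (label-coord ep cp) (label-coord eq cq) adj))

open Indices

theorem3p6 : (j : ℕ) → 1 ≤ j →
    ((∀ p → IsVertex j (label j p)) ×
    (∀ p q → label j p ≡ label j q → p ≡ q) ×
    (∀ x → IsVertex j x → ∃ λ p → label j p ≡ x)) ×
    (Σ (Fin (4 * j + 4) → Fin (4 * j + 4) → Bool) λ σ →
    IsOrientation (HAdjFin j) σ × (∀ p q → Smat j p q ≡ skewAdj σ p q)) ×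
    (∀ p q → (transpose (Smat j) · Smat j) p q ≡ scale (+ 4) identity p q)
theorem3p6 j 1≤j =
  (label-isVertex j , label-injective j , label-surjective j) ,
  skew-orientation (HAdjFin j) (Smat j) (Smat-ternary j) (Smat-skew j)
    (nonzero⇒HAdjFin j 1≤j) (HAdjFin⇒nonzero j 1≤j) ,
  SᵀS≡4I j 1≤j
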